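{- Let $m$ be a nonzero integer. Every binary quadratic form over $\mathbb{Z}[\frac{1}{m}]$ of discriminant $1-4m$ is $\mathrm{SL}_2(\mathbb{Z}[\frac{1}{m}])$-equivalent to a binary quadratic form with coefficients in $\mathbb{Z}$.
   Context: A binary quadratic form $Q(x,y)=ax^2+bxy+cy^2$ over a ring $B$ has discriminant $b^2-4ac$; $\mathrm{SL}_2(B)$ acts by linear change of variables. -}

module Defs where

open import Data.Nat using (ℕ)
open import Data.Integer as ℤ using (ℤ)
open import Data.Rational using (ℚ; _/_; _+_; _*_; _-_)
open import Data.Product using (∃-syntax; _×_)
open import Relation.Binary.PropositionalEquality using (_≡_)

ℤ→ℚ : ℤ → ℚ
ℤ→ℚ z = z / 1

InZ[1/_] : ℤ → ℚ → Set
InZ[1/ m ] q = ∃[ k ] ∃[ a ] (q * ℤ→ℚ (m ℤ.^ k) ≡ ℤ→ℚ a)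

-- binary quadratic form  a x² + b x y + c y²  with rational coefficients
record BQF : Set where
  constructor bqf
  field
    a b c : ℚ
open BQF public

FormOver : ℤ → BQF → Set
FormOver m Q = InZ[1/ m ] (a Q) × InZ[1/ m ] (b Q) × InZ[1/ m ] (c Q)

IntegralForm : BQF → Set
IntegralForm Q = ∃[ a′ ] ∃[ b′ ] ∃[ c′ ] (Q ≡ bqf (ℤ→ℚ a′) (ℤ→ℚ b′) (ℤ→ℚ c′))

two four : ℚ
two = ℤ→ℚ (ℤ.+ 2)
four = ℤ→ℚ (ℤ.+ 4)

disc : BQF → ℚ
disc (bqf a b c) = b * b - four * a * c

record Mat2 : Set where
  constructor mat
  field
    α β γ δ : ℚ
open Mat2 public

det : Mat2 → ℚ
det (mat α β γ δ) = α * δ - β * γ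

InSL2 : ℤ → Mat2 → Set
InSL2 m M = InZ[1/ m ] (α M) × InZ[1/ m ] (β M) × InZ[1/ m ] (γ M) × InZ[1/ m ] (δ M)
          × det M ≡ ℤ→ℚ (ℤ.+ 1)

-- linear change of variables: (Q·M)(x,y) = Q(αx+βy, γx+δy)
act : BQF → Mat2 → BQF
act (bqf a b c) (mat α β γ δ) =
  bqf (a * α * α + b * α * γ + c * γ * γ)
      (two * a * α * β + b * (α * δ + β * γ) + two * c * γ * δ)
      (a * β * β + b * β * δ + c * δ * δ)

SL2Equiv : ℤ → BQF → BQF → Set
SL2Equiv m Q Q′ = ∃[ M ] (InSL2 m M × act Q M ≡ Q′)

{-# OPTIONS --safe #-}
-- A unimodular change of variables makes the leading coefficient nonzero, and diag(m^k, m^-k)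
-- then makes it a nonzero integer A. It remains to find t ∈ ℤ[1/m] for which the translate
-- Q(x + t y, y) = A x² + (2At + b) x y + Q(t, 1) y² is integral. Write 4A = g h with g dividing
-- a power m^N and h coprime to m, and let s be a square root of D = 1 − 4m modulo m^N (obtained
-- from the m-adic root of x² − x + m). Take z ≡ s (mod m^N) and z ≡ b (mod h) by the Chinese
-- remainder theorem and t = (z − b)/2A ∈ ℤ[1/m]. Then 2At + b = z, and 4A · Q(t, 1) = z² − D
-- is divisible by m^N, so h · Q(t, 1) is an integer; as h is invertible modulo every power of m,
-- the element Q(t, 1) of ℤ[1/m] is itself an integer.
module Submission where

open import Defs
open import Data.Nat as ℕ using (ℕ; zero; suc)
open import Data.Product using (∃-syntax; _×_; _,_; proj₁; proj₂)
open import Data.Sum using (inj₁; inj₂)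
open import Function using (_∘_)
open import Relation.Binary.PropositionalEquality

module Arithmetic where

  import Data.Nat.Properties as ℕ
  open import Data.Nat.Coprimality using (Coprime; gcd≡1⇒coprime; coprime-Bézout)
  open import Data.Nat.Divisibility using (divides)
  import Data.Nat.GCD as ℕ
  open import Data.Nat.Induction using (<-rec)
  import Data.Nat.Tactic.RingSolver as NatSolver
  open import Data.Integer as ℤ using (ℤ; +_; 0ℤ; 1ℤ; ∣_∣; -_; _+_; _-_; _*_; _^_)
  import Data.Integer.Properties as ℤ
  open import Data.Integer.Tactic.RingSolver using (solve-∀)
  open import Relation.Nullary using (yes; no)

  BézoutCoprime : ℤ → ℤ → Set
  BézoutCoprime n m = ∃[ α ] ∃[ β ] (α * n + β * m ≡ 1ℤ)

  bézout-sym : ∀ {n m} → BézoutCoprime n m → BézoutCoprime m n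
  bézout-sym {n} {m} (α , β , e) = β , α , trans (ℤ.+-comm (β * m) (α * n)) e

  bézout-neg : ∀ {n m} → BézoutCoprime n m → BézoutCoprime (- n) m
  bézout-neg {n} {m} (α , β , e) = - α , β , trans (cong (_+ β * m) (neg-*-neg α n)) e
    where
    neg-*-neg : ∀ α n → - α * - n ≡ α * n
    neg-*-neg = solve-∀

  bézout-∣∣ : ∀ {n m} → BézoutCoprime (+ ∣ n ∣) m → BézoutCoprime n m
  bézout-∣∣ {n} b with ℤ.+∣i∣≡i⊎+∣i∣≡-i n
  ... | inj₁ e = subst (λ x → BézoutCoprime x _) e b
  ... | inj₂ e = subst (λ x → BézoutCoprime x _) (ℤ.neg-involutive n)
                   (bézout-neg (subst (λ x → BézoutCoprime x _) e b))

  coprime⇒bézout : ∀ {n m} → Coprime ∣ n ∣ ∣ m ∣ → BézoutCoprime n m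
  coprime⇒bézout {n} {m} c =
    bézout-∣∣ (bézout-sym (bézout-∣∣ (bézout-sym (fromIdentity (coprime-Bézout c)))))
    where
    open ≡-Reasoning
    lift : ∀ x y a b → 1 ℕ.+ y ℕ.* b ≡ x ℕ.* a → + x * + a ≡ 1ℤ + + y * + b
    lift x y a b eq =
      trans (sym (ℤ.pos-* x a)) (trans (cong +_ (sym eq)) (cong (λ z → 1ℤ + z) (ℤ.pos-* y b)))
    fromIdentity : ∀ {a b} → ℕ.Bézout.Identity 1 a b → BézoutCoprime (+ a) (+ b)
    fromIdentity {a} {b} (ℕ.Bézout.+- x y eq) = + x , - + y , (begin
      + x * + a + - + y * + b         ≡⟨ cong (_+ - + y * + b) (lift x y a b eq) ⟩
      1ℤ + + y * + b + - + y * + b    ≡⟨ cancel (+ y) (+ b) ⟩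
      1ℤ                              ∎)
      where
      cancel : ∀ y b → 1ℤ + y * b + - y * b ≡ 1ℤ
      cancel = solve-∀
    fromIdentity {a} {b} (ℕ.Bézout.-+ x y eq) = - + x , + y , (begin
      - + x * + a + + y * + b         ≡⟨ cong (λ z → - + x * + a + z) (lift y x b a eq) ⟩
      - + x * + a + (1ℤ + + x * + a)  ≡⟨ cancel (+ x) (+ a) ⟩
      1ℤ                              ∎)
      where
      cancel : ∀ x a → - x * a + (1ℤ + x * a) ≡ 1ℤ
      cancel = solve-∀

  bézout-* : ∀ {n m m′} → BézoutCoprime n m → BézoutCoprime n m′ → BézoutCoprime n (m * m′)
  bézout-* {n} {m} {m′} (α , β , e) (α′ , β′ , e′) =
    α * α′ * n + α * β′ * m′ + α′ * β * m , β * β′ , (begin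
      (α * α′ * n + α * β′ * m′ + α′ * β * m) * n + β * β′ * (m * m′)
        ≡⟨ expand α β α′ β′ n m m′ ⟩
      (α * n + β * m) * (α′ * n + β′ * m′)
        ≡⟨ cong₂ _*_ e e′ ⟩
      1ℤ ∎)
    where
    open ≡-Reasoning
    expand : ∀ α β α′ β′ n m m′ →
      (α * α′ * n + α * β′ * m′ + α′ * β * m) * n + β * β′ * (m * m′)
      ≡ (α * n + β * m) * (α′ * n + β′ * m′)
    expand = solve-∀

  bézout-^ : ∀ {n m} → BézoutCoprime n m → ∀ k → BézoutCoprime n (m ^ k)
  bézout-^ {n} b zero      = 0ℤ , 1ℤ , cong (_+ 1ℤ) (ℤ.*-zeroˡ n)
  bézout-^     b (suc k)   = bézout-* b (bézout-^ b k)

  record CoprimeSplitℕ (M x : ℕ) : Set where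
    constructor splitℕ
    field
      g h N r : ℕ
      x≡g*h   : x ≡ g ℕ.* h
      g*r≡M^N : g ℕ.* r ≡ M ℕ.^ N
      h⊥M     : Coprime h M

  coprimeSplitℕ : ∀ M x → x ≢ 0 → CoprimeSplitℕ M x
  coprimeSplitℕ M = <-rec (λ x → x ≢ 0 → CoprimeSplitℕ M x) split-off
    where
    split-off : ∀ x → (∀ {y} → y ℕ.< x → y ≢ 0 → CoprimeSplitℕ M y) → x ≢ 0 → CoprimeSplitℕ M x
    split-off x rec x≢0 with ℕ.gcd x M ℕ.≟ 1
    ... | yes d≡1 = splitℕ 1 x 0 1 (sym (ℕ.*-identityˡ x)) refl (gcd≡1⇒coprime d≡1)
    ... | no d≢1 with ℕ.gcd[m,n]∣m x M | ℕ.gcd[m,n]∣n x M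
    ...   | divides q x≡q*d | divides q′ M≡q′*d =
      splitℕ (d ℕ.* g) h (suc N) (q′ ℕ.* r)
        (trans x≡q*d (trans (cong (ℕ._* d) x≡g*h) (regroupˡ g h d)))
        (trans (regroupʳ d g q′ r) (cong₂ ℕ._*_ (sym M≡q′*d) g*r≡M^N))
        h⊥M
      where
      d = ℕ.gcd x M
      q≢0 : q ≢ 0
      q≢0 q≡0 = x≢0 (trans x≡q*d (cong (ℕ._* d) q≡0))
      1<d : 1 ℕ.< d
      1<d = ℕ.≤∧≢⇒< (ℕ.n≢0⇒n>0 (ℕ.gcd[m,n]≢0 x M (inj₁ x≢0))) (d≢1 ∘ sym)
      q<x : q ℕ.< x
      q<x = subst (q ℕ.<_) (sym x≡q*d) (ℕ.m<m*n q d {{ℕ.≢-nonZero q≢0}} 1<d)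
      open CoprimeSplitℕ (rec q<x q≢0)
      regroupˡ : ∀ g h d → g ℕ.* h ℕ.* d ≡ d ℕ.* g ℕ.* h
      regroupˡ = NatSolver.solve-∀
      regroupʳ : ∀ d g q′ r → d ℕ.* g ℕ.* (q′ ℕ.* r) ≡ q′ ℕ.* d ℕ.* (g ℕ.* r)
      regroupʳ = NatSolver.solve-∀

  record CoprimeSplit (m x : ℤ) : Set where
    constructor split
    field
      g h r   : ℤ
      N       : ℕ
      x≡g*h   : x ≡ g * h
      g*r≡m^N : g * r ≡ m ^ N
      h⊥m     : BézoutCoprime h m

  coprimeSplit-neg : ∀ {m x} → CoprimeSplit m x → CoprimeSplit m (- x)
  coprimeSplit-neg (split g h r N x≡g*h g*r≡m^N h⊥m) =
    split g (- h) r N (trans (cong -_ x≡g*h) (ℤ.neg-distribʳ-* g h)) g*r≡m^N (bézout-neg h⊥m)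

  coprimeSplit-∣∣ : ∀ {m x} → CoprimeSplit m (+ ∣ x ∣) → CoprimeSplit m x
  coprimeSplit-∣∣ {m} {x} s with ℤ.+∣i∣≡i⊎+∣i∣≡-i x
  ... | inj₁ e = subst (CoprimeSplit m) e s
  ... | inj₂ e = subst (CoprimeSplit m) (ℤ.neg-involutive x) (coprimeSplit-neg (subst (CoprimeSplit m) e s))

  ∣i^n∣≡∣i∣^n : ∀ i n → ∣ i ^ n ∣ ≡ ∣ i ∣ ℕ.^ n
  ∣i^n∣≡∣i∣^n i zero    = refl
  ∣i^n∣≡∣i∣^n i (suc n) = trans (ℤ.abs-* i (i ^ n)) (cong (∣ i ∣ ℕ.*_) (∣i^n∣≡∣i∣^n i n))

  divides-∣∣ : ∀ g r y → g * r ≡ + ∣ y ∣ → ∃[ r′ ] (g * r′ ≡ y)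
  divides-∣∣ g r y g*r≡ with ℤ.+∣i∣≡i⊎+∣i∣≡-i y
  ... | inj₁ e = r , trans g*r≡ e
  ... | inj₂ e = - r , trans (sym (ℤ.neg-distribʳ-* g r)) (trans (cong -_ (trans g*r≡ e)) (ℤ.neg-involutive y))

  coprimeSplit : ∀ m {x} → x ≢ 0ℤ → CoprimeSplit m x
  coprimeSplit m {x} x≢0 =
    coprimeSplit-∣∣ (split (+ g) (+ h) r′ N (trans (cong +_ x≡g*h) (ℤ.pos-* g h)) g*r′≡m^N
                           (coprime⇒bézout h⊥M))
    where
    open CoprimeSplitℕ (coprimeSplitℕ ∣ m ∣ ∣ x ∣ (x≢0 ∘ ℤ.∣i∣≡0⇒i≡0))
    power-part : ∃[ r′ ] (+ g * r′ ≡ m ^ N)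
    power-part = divides-∣∣ (+ g) (+ r) (m ^ N)
                   (trans (sym (ℤ.pos-* g r)) (cong +_ (trans g*r≡M^N (sym (∣i^n∣≡∣i∣^n m N)))))
    r′ = proj₁ power-part
    g*r′≡m^N = proj₂ power-part

  SquareModPowers : ℤ → ℤ → Set
  SquareModPowers m D = ∀ N → ∃[ s ] ∃[ E ] (s * s ≡ D + m ^ N * E)

  -- Iterating x ↦ x² + m from 0 converges m-adically to a root of x² − x + m.
  approxRoot : ℤ → ℕ → ℤ
  approxRoot m zero    = 0ℤ
  approxRoot m (suc j) = approxRoot m j * approxRoot m j + m

  m∣approxRoot : ∀ m j → ∃[ r ] (approxRoot m j ≡ m * r)
  m∣approxRoot m zero    = 0ℤ , sym (ℤ.*-zeroʳ m)
  m∣approxRoot m (suc j) with m∣approxRoot m j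
  ... | r , x≡m*r = r * (m * r) + 1ℤ , trans (cong (λ x → x * x + m) x≡m*r) (factor m r)
    where
    factor : ∀ m r → m * r * (m * r) + m ≡ m * (r * (m * r) + 1ℤ)
    factor = solve-∀

  approxRoot-step : ∀ m j → ∃[ E ] (approxRoot m (suc j) - approxRoot m j ≡ m ^ j * E)
  approxRoot-step m zero    = m , first-step m
    where
    first-step : ∀ m → (0ℤ * 0ℤ + m) - 0ℤ ≡ 1ℤ * m
    first-step = solve-∀
  approxRoot-step m (suc j) with approxRoot-step m j | m∣approxRoot m (suc j) | m∣approxRoot m j
  ... | E , x-y≡ | r′ , x≡ | r , y≡ = E * (r′ + r) , (begin
      (x * x + m) - (y * y + m)        ≡⟨ difference-of-squares x y m ⟩
      (x - y) * (x + y)                ≡⟨ cong₂ _*_ x-y≡ (cong₂ _+_ x≡ y≡) ⟩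
      m ^ j * E * (m * r′ + m * r)     ≡⟨ regroup (m ^ j) m E r′ r ⟩
      m * m ^ j * (E * (r′ + r))       ∎)
    where
    open ≡-Reasoning
    x = approxRoot m (suc j)
    y = approxRoot m j
    difference-of-squares : ∀ x y m → (x * x + m) - (y * y + m) ≡ (x - y) * (x + y)
    difference-of-squares = solve-∀
    regroup : ∀ p m E r′ r → p * E * (m * r′ + m * r) ≡ m * p * (E * (r′ + r))
    regroup = solve-∀

  1-4m-squareModPowers : ∀ m → SquareModPowers m (1ℤ - + 4 * m)
  1-4m-squareModPowers m N with approxRoot-step m N
  ... | E , step = 1ℤ - + 2 * y , + 4 * E , (begin
      (1ℤ - + 2 * y) * (1ℤ - + 2 * y)         ≡⟨ complete-square y m ⟩
      1ℤ - + 4 * m + + 4 * ((y * y + m) - y)  ≡⟨ cong (λ z → 1ℤ - + 4 * m + + 4 * z) step ⟩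
      1ℤ - + 4 * m + + 4 * (m ^ N * E)         ≡⟨ regroup (1ℤ - + 4 * m) (m ^ N) E ⟩
      1ℤ - + 4 * m + m ^ N * (+ 4 * E)         ∎)
    where
    open ≡-Reasoning
    y = approxRoot m N
    complete-square : ∀ y m → (1ℤ - + 2 * y) * (1ℤ - + 2 * y) ≡ 1ℤ - + 4 * m + + 4 * ((y * y + m) - y)
    complete-square = solve-∀
    regroup : ∀ D p E → D + + 4 * (p * E) ≡ D + p * (+ 4 * E)
    regroup = solve-∀

  -- The left-hand side is the Chinese-remainder solution of z ≡ s (mod p), z · mk ≡ B (mod h).
  crt-combination : ∀ α β h mk p s B → α * h + β * (mk * p) ≡ 1ℤ →
                    α * h * s + β * p * B ≡ s + p * (β * (B - s * mk))
  crt-combination α β h mk p s B αh+βmkp≡1 = begin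
    α * h * s + β * p * B                                   ≡⟨ expand α β h mk p s B ⟩
    s * (α * h + β * (mk * p)) + p * (β * (B - s * mk))    ≡⟨ cong (λ u → s * u + p * (β * (B - s * mk))) αh+βmkp≡1 ⟩
    s * 1ℤ + p * (β * (B - s * mk))                         ≡⟨ cong (_+ p * (β * (B - s * mk))) (ℤ.*-identityʳ s) ⟩
    s + p * (β * (B - s * mk))                              ∎
    where
    open ≡-Reasoning
    expand : ∀ α β h mk p s B → α * h * s + β * p * B ≡ s * (α * h + β * (mk * p)) + p * (β * (B - s * mk))
    expand = solve-∀

  square-congruence : ∀ s D p E e {z} → s * s ≡ D + p * E → z ≡ s + p * e → ∃[ V ] (z * z - D ≡ p * V)
  square-congruence s D p E e s²≡D+pE refl = E + + 2 * s * e + p * e * e , (begin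
    (s + p * e) * (s + p * e) - D                   ≡⟨ expand s p e D ⟩
    s * s - D + p * (+ 2 * s * e + p * e * e)       ≡⟨ cong (λ u → u - D + p * (+ 2 * s * e + p * e * e)) s²≡D+pE ⟩
    D + p * E - D + p * (+ 2 * s * e + p * e * e)   ≡⟨ collect D p E s e ⟩
    p * (E + + 2 * s * e + p * e * e)               ∎)
    where
    open ≡-Reasoning
    expand : ∀ s p e D → (s + p * e) * (s + p * e) - D ≡ s * s - D + p * (+ 2 * s * e + p * e * e)
    expand = solve-∀
    collect : ∀ D p E s e → D + p * E - D + p * (+ 2 * s * e + p * e * e) ≡ p * (E + + 2 * s * e + p * e * e)
    collect = solve-∀

  1-4m≢0 : ∀ m → 1ℤ - + 4 * m ≢ 0ℤ
  1-4m≢0 m 1-4m≡0 = 4≢1 (ℕ.m*n≡1⇒m≡1 4 ∣ m ∣ (sym (trans (cong ∣_∣ 1≡4m) (ℤ.abs-* (+ 4) m))))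
    where
    1≡4m : 1ℤ ≡ + 4 * m
    1≡4m = ℤ.i-j≡0⇒i≡j 1ℤ (+ 4 * m) 1-4m≡0
    4≢1 : 4 ≢ 1
    4≢1 ()

module Forms where

  open Arithmetic
  open import Data.Integer as ℤ using (ℤ; +_; +[1+_]; -[1+_]; 0ℤ; 1ℤ; ∣_∣)
  import Data.Integer.Properties as ℤ
  open import Data.Nat.Coprimality using (1-coprimeTo) renaming (sym to coprime-sym)
  open import Data.Rational as ℚ using (ℚ; mkℚ; 0ℚ; 1ℚ; ↥_; _+_; _*_; _-_; -_; 1/_)
  import Data.Rational.Properties as ℚ
  open import Level using (0ℓ)
  open import Relation.Nullary using (yes; no)
  open import Relation.Nullary.Decidable using (dec⇒maybe)
  open import Tactic.RingSolver using (solve-∀)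
  open import Tactic.RingSolver.Core.AlmostCommutativeRing using (AlmostCommutativeRing; fromCommutativeRing)

  ℚ-ring : AlmostCommutativeRing 0ℓ 0ℓ
  ℚ-ring = fromCommutativeRing ℚ.+-*-commutativeRing (λ x → dec⇒maybe (0ℚ ℚ.≟ x))

  infix 9 ↑_
  ↑_ : ℤ → ℚ
  ↑_ = ℤ→ℚ

  ↑-mkℚ : ∀ z → ↑ z ≡ mkℚ z 0 (coprime-sym (1-coprimeTo ∣ z ∣))
  ↑-mkℚ z = ℚ.↥p/↧p≡p (mkℚ z 0 (coprime-sym (1-coprimeTo ∣ z ∣)))

  ↑-+ : ∀ x y → ↑ (x ℤ.+ y) ≡ ↑ x + ↑ y
  ↑-+ x y rewrite ↑-mkℚ x | ↑-mkℚ y =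
    cong (ℚ._/ 1) (cong₂ ℤ._+_ (sym (ℤ.*-identityʳ x)) (sym (ℤ.*-identityʳ y)))

  ↑-* : ∀ x y → ↑ (x ℤ.* y) ≡ ↑ x * ↑ y
  ↑-* x y rewrite ↑-mkℚ x | ↑-mkℚ y = refl

  ↑-neg : ∀ x → ↑ (ℤ.- x) ≡ - ↑ x
  ↑-neg (+ zero) = refl
  ↑-neg +[1+ n ] rewrite ↑-mkℚ +[1+ n ] = refl
  ↑-neg -[1+ n ] rewrite ↑-mkℚ +[1+ n ] = refl

  ↑-- : ∀ x y → ↑ (x ℤ.- y) ≡ ↑ x - ↑ y
  ↑-- x y = trans (↑-+ x (ℤ.- y)) (cong (λ w → ↑ x + w) (↑-neg y))

  ↑-injective : ∀ {x y} → ↑ x ≡ ↑ y → x ≡ y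
  ↑-injective {x} {y} eq rewrite ↑-mkℚ x | ↑-mkℚ y = cong ↥_ eq

  ↑-*+* : ∀ a x b y → ↑ (a ℤ.* x ℤ.+ b ℤ.* y) ≡ ↑ a * ↑ x + ↑ b * ↑ y
  ↑-*+* a x b y = trans (↑-+ (a ℤ.* x) (b ℤ.* y)) (cong₂ _+_ (↑-* a x) (↑-* b y))

  Integral : ℚ → Set
  Integral x = ∃[ z ] (x ≡ ↑ z)

  bqf-cong : ∀ {a a′ b b′ c c′} → a ≡ a′ → b ≡ b′ → c ≡ c′ → bqf a b c ≡ bqf a′ b′ c′
  bqf-cong refl refl refl = refl

  infixl 7 _*ᴹ_
  _*ᴹ_ : Mat2 → Mat2 → Mat2
  mat α β γ δ *ᴹ mat α′ β′ γ′ δ′ =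
    mat (α * α′ + β * γ′) (α * β′ + β * δ′) (γ * α′ + δ * γ′) (γ * β′ + δ * δ′)

  I₂ : Mat2
  I₂ = mat 1ℚ 0ℚ 0ℚ 1ℚ

  act-I₂ : ∀ Q → act Q I₂ ≡ Q
  act-I₂ (bqf a b c) = bqf-cong (coeff-a a b c) (coeff-b a b c) (coeff-c a b c)
    where
    coeff-a : ∀ a b c → a * 1ℚ * 1ℚ + b * 1ℚ * 0ℚ + c * 0ℚ * 0ℚ ≡ a
    coeff-a = solve-∀ ℚ-ring
    coeff-b : ∀ a b c → two * a * 1ℚ * 0ℚ + b * (1ℚ * 1ℚ + 0ℚ * 0ℚ) + two * c * 0ℚ * 1ℚ ≡ b
    coeff-b = solve-∀ ℚ-ring
    coeff-c : ∀ a b c → a * 0ℚ * 0ℚ + b * 0ℚ * 1ℚ + c * 1ℚ * 1ℚ ≡ c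
    coeff-c = solve-∀ ℚ-ring

  act-*ᴹ : ∀ Q M M′ → act (act Q M) M′ ≡ act Q (M *ᴹ M′)
  act-*ᴹ (bqf a b c) (mat α β γ δ) (mat α′ β′ γ′ δ′) = bqf-cong
    (coeff-a a b c α β γ δ α′ β′ γ′ δ′)
    (coeff-b a b c α β γ δ α′ β′ γ′ δ′)
    (coeff-c a b c α β γ δ α′ β′ γ′ δ′)
    where
    coeff-a : ∀ a b c α β γ δ α′ β′ γ′ δ′ →
      (a * α * α + b * α * γ + c * γ * γ) * α′ * α′
      + (two * a * α * β + b * (α * δ + β * γ) + two * c * γ * δ) * α′ * γ′
      + (a * β * β + b * β * δ + c * δ * δ) * γ′ * γ′
      ≡ a * (α * α′ + β * γ′) * (α * α′ + β * γ′) + b * (α * α′ + β * γ′) * (γ * α′ + δ * γ′)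
        + c * (γ * α′ + δ * γ′) * (γ * α′ + δ * γ′)
    coeff-a = solve-∀ ℚ-ring
    coeff-b : ∀ a b c α β γ δ α′ β′ γ′ δ′ →
      two * (a * α * α + b * α * γ + c * γ * γ) * α′ * β′
      + (two * a * α * β + b * (α * δ + β * γ) + two * c * γ * δ) * (α′ * δ′ + β′ * γ′)
      + two * (a * β * β + b * β * δ + c * δ * δ) * γ′ * δ′
      ≡ two * a * (α * α′ + β * γ′) * (α * β′ + β * δ′)
        + b * ((α * α′ + β * γ′) * (γ * β′ + δ * δ′) + (α * β′ + β * δ′) * (γ * α′ + δ * γ′))
        + two * c * (γ * α′ + δ * γ′) * (γ * β′ + δ * δ′)
    coeff-b = solve-∀ ℚ-ring
    coeff-c : ∀ a b c α β γ δ α′ β′ γ′ δ′ →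
      (a * α * α + b * α * γ + c * γ * γ) * β′ * β′
      + (two * a * α * β + b * (α * δ + β * γ) + two * c * γ * δ) * β′ * δ′
      + (a * β * β + b * β * δ + c * δ * δ) * δ′ * δ′
      ≡ a * (α * β′ + β * δ′) * (α * β′ + β * δ′) + b * (α * β′ + β * δ′) * (γ * β′ + δ * δ′)
        + c * (γ * β′ + δ * δ′) * (γ * β′ + δ * δ′)
    coeff-c = solve-∀ ℚ-ring

  det-*ᴹ : ∀ M M′ → det (M *ᴹ M′) ≡ det M * det M′
  det-*ᴹ (mat α β γ δ) (mat α′ β′ γ′ δ′) = expand α β γ δ α′ β′ γ′ δ′
    where
    expand : ∀ α β γ δ α′ β′ γ′ δ′ →
      (α * α′ + β * γ′) * (γ * β′ + δ * δ′) - (α * β′ + β * δ′) * (γ * α′ + δ * γ′)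
      ≡ (α * δ - β * γ) * (α′ * δ′ - β′ * γ′)
    expand = solve-∀ ℚ-ring

  disc-act : ∀ Q M → disc (act Q M) ≡ det M * det M * disc Q
  disc-act (bqf a b c) (mat α β γ δ) = expand a b c α β γ δ
    where
    expand : ∀ a b c α β γ δ →
      (two * a * α * β + b * (α * δ + β * γ) + two * c * γ * δ)
      * (two * a * α * β + b * (α * δ + β * γ) + two * c * γ * δ)
      - four * (a * α * α + b * α * γ + c * γ * γ) * (a * β * β + b * β * δ + c * δ * δ)
      ≡ (α * δ - β * γ) * (α * δ - β * γ) * (b * b - four * a * c)
    expand = solve-∀ ℚ-ring

  module Localisation (m : ℤ) (m≢0 : m ≢ 0ℤ) where

    -- A record rather than InZ[1/ m ] itself, so that x is inferable from a proof of x ∈ℤ[1/m].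
    infix 4 _∈ℤ[1/m]
    record _∈ℤ[1/m] (x : ℚ) : Set where
      constructor inℤ[1/m]
      field witness : InZ[1/ m ] x
    open _∈ℤ[1/m]

    instance
      ↑m-nonZero : ℚ.NonZero (↑ m)
      ↑m-nonZero = ℚ.≢-nonZero (m≢0 ∘ ↑-injective)

    m^_ : ℕ → ℚ
    m^ k = ↑ (m ℤ.^ k)

    m⁻^_ : ℕ → ℚ
    m⁻^ zero    = 1ℚ
    m⁻^ (suc k) = 1/ ↑ m * m⁻^ k

    m^-+ : ∀ k l → m^ (k ℕ.+ l) ≡ m^ k * m^ l
    m^-+ k l = trans (cong ↑_ (ℤ.^-distribˡ-+-* m k l)) (↑-* (m ℤ.^ k) (m ℤ.^ l))

    m^*m⁻^ : ∀ k → m^ k * m⁻^ k ≡ 1ℚ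
    m^*m⁻^ zero    = refl
    m^*m⁻^ (suc k) = begin
      m^ suc k * (1/ ↑ m * m⁻^ k)        ≡⟨ cong (_* (1/ ↑ m * m⁻^ k)) (↑-* m (m ℤ.^ k)) ⟩
      ↑ m * m^ k * (1/ ↑ m * m⁻^ k)      ≡⟨ regroup (↑ m) (m^ k) (1/ ↑ m) (m⁻^ k) ⟩
      (↑ m * 1/ ↑ m) * (m^ k * m⁻^ k)    ≡⟨ cong₂ _*_ (ℚ.*-inverseʳ (↑ m)) (m^*m⁻^ k) ⟩
      1ℚ                                 ∎
      where
      open ≡-Reasoning
      regroup : ∀ a b c d → a * b * (c * d) ≡ (a * c) * (b * d)
      regroup = solve-∀ ℚ-ring

    ↑-closed : ∀ z → ↑ z ∈ℤ[1/m]
    ↑-closed z = inℤ[1/m] (0 , z , ℚ.*-identityʳ (↑ z))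

    +-closed : ∀ {x y} → x ∈ℤ[1/m] → y ∈ℤ[1/m] → (x + y) ∈ℤ[1/m]
    +-closed {x} {y} (inℤ[1/m] (k , a , xm^k≡a)) (inℤ[1/m] (l , b , ym^l≡b)) =
      inℤ[1/m] (k ℕ.+ l , a ℤ.* m ℤ.^ l ℤ.+ b ℤ.* m ℤ.^ k , (begin
        (x + y) * m^ (k ℕ.+ l)           ≡⟨ cong ((x + y) *_) (m^-+ k l) ⟩
        (x + y) * (m^ k * m^ l)          ≡⟨ regroup x y (m^ k) (m^ l) ⟩
        x * m^ k * m^ l + y * m^ l * m^ k ≡⟨ cong₂ (λ u v → u * m^ l + v * m^ k) xm^k≡a ym^l≡b ⟩
        ↑ a * m^ l + ↑ b * m^ k          ≡⟨ sym (↑-*+* a (m ℤ.^ l) b (m ℤ.^ k)) ⟩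
        ↑ (a ℤ.* m ℤ.^ l ℤ.+ b ℤ.* m ℤ.^ k) ∎))
      where
      open ≡-Reasoning
      regroup : ∀ x y p q → (x + y) * (p * q) ≡ x * p * q + y * q * p
      regroup = solve-∀ ℚ-ring

    *-closed : ∀ {x y} → x ∈ℤ[1/m] → y ∈ℤ[1/m] → (x * y) ∈ℤ[1/m]
    *-closed {x} {y} (inℤ[1/m] (k , a , xm^k≡a)) (inℤ[1/m] (l , b , ym^l≡b)) =
      inℤ[1/m] (k ℕ.+ l , a ℤ.* b , (begin
        (x * y) * m^ (k ℕ.+ l)        ≡⟨ cong ((x * y) *_) (m^-+ k l) ⟩
        (x * y) * (m^ k * m^ l)       ≡⟨ regroup x y (m^ k) (m^ l) ⟩
        (x * m^ k) * (y * m^ l)       ≡⟨ cong₂ _*_ xm^k≡a ym^l≡b ⟩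
        ↑ a * ↑ b                     ≡⟨ sym (↑-* a b) ⟩
        ↑ (a ℤ.* b)                   ∎))
      where
      open ≡-Reasoning
      regroup : ∀ x y p q → (x * y) * (p * q) ≡ (x * p) * (y * q)
      regroup = solve-∀ ℚ-ring

    neg-closed : ∀ {x} → x ∈ℤ[1/m] → (- x) ∈ℤ[1/m]
    neg-closed {x} (inℤ[1/m] (k , a , xm^k≡a)) =
      inℤ[1/m] (k , ℤ.- a , trans (neg-* x (m^ k)) (trans (cong -_ xm^k≡a) (sym (↑-neg a))))
      where
      neg-* : ∀ x p → (- x) * p ≡ - (x * p)
      neg-* = solve-∀ ℚ-ring

    m⁻^-closed : ∀ k → (m⁻^ k) ∈ℤ[1/m]
    m⁻^-closed k = inℤ[1/m] (k , 1ℤ , trans (ℚ.*-comm (m⁻^ k) (m^ k)) (m^*m⁻^ k))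

    coprime-multiple-integral : ∀ {x} n y → x ∈ℤ[1/m] → ↑ n * x ≡ ↑ y → BézoutCoprime n m → Integral x
    coprime-multiple-integral {x} n y (inℤ[1/m] (k , a , xm^k≡a)) nx≡y n⊥m
      with bézout-^ n⊥m k
    ... | α , β , αn+βm^k≡1 = α ℤ.* y ℤ.+ β ℤ.* a , (begin
      x                                ≡⟨ sym (ℚ.*-identityʳ x) ⟩
      x * 1ℚ                           ≡⟨ cong (λ w → x * ↑ w) (sym αn+βm^k≡1) ⟩
      x * ↑ (α ℤ.* n ℤ.+ β ℤ.* m ℤ.^ k) ≡⟨ cong (x *_) (↑-*+* α n β (m ℤ.^ k)) ⟩
      x * (↑ α * ↑ n + ↑ β * m^ k)     ≡⟨ regroup x (↑ α) (↑ n) (↑ β) (m^ k) ⟩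
      ↑ α * (↑ n * x) + ↑ β * (x * m^ k) ≡⟨ cong₂ (λ u v → ↑ α * u + ↑ β * v) nx≡y xm^k≡a ⟩
      ↑ α * ↑ y + ↑ β * ↑ a            ≡⟨ sym (↑-*+* α y β a) ⟩
      ↑ (α ℤ.* y ℤ.+ β ℤ.* a)          ∎)
      where
      open ≡-Reasoning
      regroup : ∀ x a n b p → x * (a * n + b * p) ≡ a * (n * x) + b * (x * p)
      regroup = solve-∀ ℚ-ring

    formOver-closed : ∀ Q → FormOver m Q → a Q ∈ℤ[1/m] × b Q ∈ℤ[1/m] × c Q ∈ℤ[1/m]
    formOver-closed _ (a∈ , b∈ , c∈) = inℤ[1/m] a∈ , inℤ[1/m] b∈ , inℤ[1/m] c∈

    InSL2-closed : ∀ M → InSL2 m M → α M ∈ℤ[1/m] × β M ∈ℤ[1/m] × γ M ∈ℤ[1/m] × δ M ∈ℤ[1/m]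
    InSL2-closed _ (α∈ , β∈ , γ∈ , δ∈ , _) = inℤ[1/m] α∈ , inℤ[1/m] β∈ , inℤ[1/m] γ∈ , inℤ[1/m] δ∈

    act-formOver : ∀ Q M → FormOver m Q → InSL2 m M → FormOver m (act Q M)
    act-formOver Q@(bqf _ _ _) M@(mat _ _ _ _) Q∈ M∈
      with formOver-closed Q Q∈ | InSL2-closed M M∈
    ... | a , b , c | α , β , γ , δ =
      witness (+-closed (+-closed (*-closed (*-closed a α) α) (*-closed (*-closed b α) γ))
                        (*-closed (*-closed c γ) γ)) ,
      witness (+-closed (+-closed (*-closed (*-closed (*-closed two∈ a) α) β)
                                  (*-closed b (+-closed (*-closed α δ) (*-closed β γ))))
                        (*-closed (*-closed (*-closed two∈ c) γ) δ)) ,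
      witness (+-closed (+-closed (*-closed (*-closed a β) β) (*-closed (*-closed b β) δ))
                        (*-closed (*-closed c δ) δ))
      where
      two∈ = ↑-closed (+ 2)

    *ᴹ-InSL2 : ∀ M M′ → InSL2 m M → InSL2 m M′ → InSL2 m (M *ᴹ M′)
    *ᴹ-InSL2 M@(mat _ _ _ _) M′@(mat _ _ _ _) M∈@(_ , _ , _ , _ , detM≡1) M′∈@(_ , _ , _ , _ , detM′≡1)
      with InSL2-closed M M∈ | InSL2-closed M′ M′∈
    ... | α , β , γ , δ | α′ , β′ , γ′ , δ′ =
      entry α α′ γ′ β , entry α β′ δ′ β , entry γ α′ γ′ δ , entry γ β′ δ′ δ ,
      trans (det-*ᴹ M M′) (cong₂ _*_ detM≡1 detM′≡1)
      where
      entry : ∀ {x y z w} → x ∈ℤ[1/m] → y ∈ℤ[1/m] → z ∈ℤ[1/m] → w ∈ℤ[1/m] → InZ[1/ m ] (x * y + w * z)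
      entry x y z w = witness (+-closed (*-closed x y) (*-closed w z))

    integral-InSL2 : ∀ α β γ δ → det (mat (↑ α) (↑ β) (↑ γ) (↑ δ)) ≡ ↑ 1ℤ → InSL2 m (mat (↑ α) (↑ β) (↑ γ) (↑ δ))
    integral-InSL2 α β γ δ det≡1 =
      witness (↑-closed α) , witness (↑-closed β) , witness (↑-closed γ) , witness (↑-closed δ) , det≡1

    SL2Equiv-refl : ∀ Q → SL2Equiv m Q Q
    SL2Equiv-refl Q = I₂ , integral-InSL2 1ℤ 0ℤ 0ℤ 1ℤ refl , act-I₂ Q

    SL2Equiv-trans : ∀ {Q Q′ Q″} → SL2Equiv m Q Q′ → SL2Equiv m Q′ Q″ → SL2Equiv m Q Q″
    SL2Equiv-trans {Q} (M , M∈ , refl) (M′ , M′∈ , refl) =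
      M *ᴹ M′ , *ᴹ-InSL2 M M′ M∈ M′∈ , sym (act-*ᴹ Q M M′)

    SL2Equiv-formOver : ∀ {Q Q′} → SL2Equiv m Q Q′ → FormOver m Q → FormOver m Q′
    SL2Equiv-formOver {Q} (M , M∈ , refl) Q∈ = act-formOver Q M Q∈ M∈

    SL2Equiv-disc : ∀ {Q Q′} → SL2Equiv m Q Q′ → disc Q′ ≡ disc Q
    SL2Equiv-disc {Q} (M , (_ , _ , _ , _ , detM≡1) , refl) = begin
      disc (act Q M)             ≡⟨ disc-act Q M ⟩
      det M * det M * disc Q     ≡⟨ cong (λ d → d * d * disc Q) detM≡1 ⟩
      1ℚ * 1ℚ * disc Q           ≡⟨ ℚ.*-identityˡ (disc Q) ⟩
      disc Q                     ∎
      where open ≡-Reasoning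

    IntegralTranslation : ℤ → ℚ → ℚ → Set
    IntegralTranslation A b c =
      ∃[ t ] (t ∈ℤ[1/m] × Integral (two * ↑ A * t + b) × Integral (↑ A * t * t + b * t + c))

    module Translation
      {A D : ℤ} {b c : ℚ} (disc≡D : b * b - four * ↑ A * c ≡ ↑ D) (c∈ : c ∈ℤ[1/m])
      {k : ℕ} {B : ℤ} (bm^k≡B : b * m^ k ≡ ↑ B)
      {g h r : ℤ} {N : ℕ} (4A≡gh : + 4 ℤ.* A ≡ g ℤ.* h) (gr≡m^N : g ℤ.* r ≡ m ℤ.^ N)
      (h⊥m : BézoutCoprime h m)
      {s E : ℤ} (s²≡D+m^NE : s ℤ.* s ≡ D ℤ.+ m ℤ.^ N ℤ.* E)
      {α β : ℤ} (αh+βm^k+N≡1 : α ℤ.* h ℤ.+ β ℤ.* m ℤ.^ (k ℕ.+ N) ≡ 1ℤ)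
      where

      open ≡-Reasoning

      -- t = (z − b)/2A, since z − b = αh(s − b), 4A = gh and 1/g = r/m^N.
      t : ℚ
      t = two * ↑ α * (↑ s - b) * ↑ r * m⁻^ N

      z : ℤ
      z = α ℤ.* h ℤ.* s ℤ.+ β ℤ.* m ℤ.^ N ℤ.* B

      q : ℚ
      q = ↑ A * t * t + b * t + c

      b∈ : b ∈ℤ[1/m]
      b∈ = inℤ[1/m] (k , B , bm^k≡B)

      t∈ : t ∈ℤ[1/m]
      t∈ = *-closed (*-closed (*-closed (*-closed (↑-closed (+ 2)) (↑-closed α))
                                       (+-closed (↑-closed s) (neg-closed b∈)))
                             (↑-closed r))
                    (m⁻^-closed N)

      q∈ : q ∈ℤ[1/m]
      q∈ = +-closed (+-closed (*-closed (*-closed (↑-closed A) t∈) t∈) (*-closed b∈ t∈)) c∈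

      four*A≡g*h : four * ↑ A ≡ ↑ g * ↑ h
      four*A≡g*h = trans (sym (↑-* (+ 4) A)) (trans (cong ↑_ 4A≡gh) (↑-* g h))

      g*r*m⁻^N≡1 : ↑ g * ↑ r * m⁻^ N ≡ 1ℚ
      g*r*m⁻^N≡1 = trans (cong (_* m⁻^ N) (trans (sym (↑-* g r)) (cong ↑_ gr≡m^N))) (m^*m⁻^ N)

      αh+βm^km^N≡1 : ↑ α * ↑ h + ↑ β * (m^ k * m^ N) ≡ 1ℚ
      αh+βm^km^N≡1 = begin
        ↑ α * ↑ h + ↑ β * (m^ k * m^ N)   ≡⟨ cong (λ w → ↑ α * ↑ h + ↑ β * w) (sym (m^-+ k N)) ⟩
        ↑ α * ↑ h + ↑ β * m^ (k ℕ.+ N)    ≡⟨ sym (↑-*+* α h β (m ℤ.^ (k ℕ.+ N))) ⟩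
        ↑ (α ℤ.* h ℤ.+ β ℤ.* m ℤ.^ (k ℕ.+ N)) ≡⟨ cong ↑_ αh+βm^k+N≡1 ⟩
        1ℚ                                 ∎

      linear-coefficient : two * ↑ A * t + b ≡ ↑ z
      linear-coefficient = begin
        two * ↑ A * t + b
          ≡⟨ regroup₁ (↑ A) (↑ α) (↑ s) b (↑ r) (m⁻^ N) ⟩
        four * ↑ A * ↑ α * (↑ s - b) * ↑ r * m⁻^ N + b
          ≡⟨ cong (λ w → w * ↑ α * (↑ s - b) * ↑ r * m⁻^ N + b) four*A≡g*h ⟩
        ↑ g * ↑ h * ↑ α * (↑ s - b) * ↑ r * m⁻^ N + b
          ≡⟨ regroup₂ (↑ g) (↑ h) (↑ α) (↑ s) b (↑ r) (m⁻^ N) ⟩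
        ↑ h * ↑ α * (↑ s - b) * (↑ g * ↑ r * m⁻^ N) + b * 1ℚ
          ≡⟨ cong₂ (λ u v → ↑ h * ↑ α * (↑ s - b) * u + b * v) g*r*m⁻^N≡1 (sym αh+βm^km^N≡1) ⟩
        ↑ h * ↑ α * (↑ s - b) * 1ℚ + b * (↑ α * ↑ h + ↑ β * (m^ k * m^ N))
          ≡⟨ regroup₃ (↑ h) (↑ α) (↑ s) b (↑ β) (m^ k) (m^ N) ⟩
        ↑ α * ↑ h * ↑ s + ↑ β * m^ N * (b * m^ k)
          ≡⟨ cong (λ w → ↑ α * ↑ h * ↑ s + ↑ β * m^ N * w) bm^k≡B ⟩
        ↑ α * ↑ h * ↑ s + ↑ β * m^ N * ↑ B
          ≡⟨ sym (cong₂ (λ u v → u * ↑ s + v * ↑ B) (↑-* α h) (↑-* β (m ℤ.^ N))) ⟩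
        ↑ (α ℤ.* h) * ↑ s + ↑ (β ℤ.* m ℤ.^ N) * ↑ B
          ≡⟨ sym (↑-*+* (α ℤ.* h) s (β ℤ.* m ℤ.^ N) B) ⟩
        ↑ z ∎
        where
        regroup₁ : ∀ A α s b r i → two * A * (two * α * (s - b) * r * i) + b ≡ four * A * α * (s - b) * r * i + b
        regroup₁ = solve-∀ ℚ-ring
        regroup₂ : ∀ g h α s b r i → g * h * α * (s - b) * r * i + b ≡ h * α * (s - b) * (g * r * i) + b * 1ℚ
        regroup₂ = solve-∀ ℚ-ring
        regroup₃ : ∀ h α s b β pk pN →
          h * α * (s - b) * 1ℚ + b * (α * h + β * (pk * pN)) ≡ α * h * s + β * pN * (b * pk)
        regroup₃ = solve-∀ ℚ-ring

      m^N∣z²-D : ∃[ V ] (z ℤ.* z ℤ.- D ≡ m ℤ.^ N ℤ.* V)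
      m^N∣z²-D = square-congruence s D (m ℤ.^ N) E (β ℤ.* (B ℤ.- s ℤ.* m ℤ.^ k)) s²≡D+m^NE
                     (crt-combination α β h (m ℤ.^ k) (m ℤ.^ N) s B αh+βm^km^N≡1′)
        where
        αh+βm^km^N≡1′ : α ℤ.* h ℤ.+ β ℤ.* (m ℤ.^ k ℤ.* m ℤ.^ N) ≡ 1ℤ
        αh+βm^km^N≡1′ = trans (cong (λ w → α ℤ.* h ℤ.+ β ℤ.* w) (sym (ℤ.^-distribˡ-+-* m k N))) αh+βm^k+N≡1

      four*A*q≡z²-D : four * ↑ A * q ≡ ↑ z * ↑ z - ↑ D
      four*A*q≡z²-D = begin
        four * ↑ A * q
          ≡⟨ complete-square (↑ A) t b c ⟩
        (two * ↑ A * t + b) * (two * ↑ A * t + b) - (b * b - four * ↑ A * c)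
          ≡⟨ cong₂ (λ u v → u * u - v) linear-coefficient disc≡D ⟩
        ↑ z * ↑ z - ↑ D ∎
        where
        complete-square : ∀ A t b c →
          four * A * (A * t * t + b * t + c) ≡ (two * A * t + b) * (two * A * t + b) - (b * b - four * A * c)
        complete-square = solve-∀ ℚ-ring

      q-integral : Integral q
      q-integral = coprime-multiple-integral h (r ℤ.* V) q∈ h*q≡r*V h⊥m
        where
        V = proj₁ m^N∣z²-D
        h*q≡r*V : ↑ h * q ≡ ↑ (r ℤ.* V)
        h*q≡r*V = begin
          ↑ h * q                               ≡⟨ sym (ℚ.*-identityʳ (↑ h * q)) ⟩
          ↑ h * q * 1ℚ                          ≡⟨ cong (↑ h * q *_) (sym g*r*m⁻^N≡1) ⟩
          ↑ h * q * (↑ g * ↑ r * m⁻^ N)         ≡⟨ regroup₁ (↑ h) q (↑ g) (↑ r) (m⁻^ N) ⟩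
          ↑ g * ↑ h * q * ↑ r * m⁻^ N           ≡⟨ cong (λ w → w * q * ↑ r * m⁻^ N) (sym four*A≡g*h) ⟩
          four * ↑ A * q * ↑ r * m⁻^ N          ≡⟨ cong (λ w → w * ↑ r * m⁻^ N) four*A*q≡z²-D ⟩
          (↑ z * ↑ z - ↑ D) * ↑ r * m⁻^ N       ≡⟨ cong (λ w → w * ↑ r * m⁻^ N) (sym z²-D-cast) ⟩
          m^ N * ↑ V * ↑ r * m⁻^ N              ≡⟨ regroup₂ (m^ N) (↑ V) (↑ r) (m⁻^ N) ⟩
          ↑ r * ↑ V * (m^ N * m⁻^ N)            ≡⟨ cong (↑ r * ↑ V *_) (m^*m⁻^ N) ⟩
          ↑ r * ↑ V * 1ℚ                        ≡⟨ ℚ.*-identityʳ (↑ r * ↑ V) ⟩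
          ↑ r * ↑ V                             ≡⟨ sym (↑-* r V) ⟩
          ↑ (r ℤ.* V)                           ∎
          where
          z²-D-cast : m^ N * ↑ V ≡ ↑ z * ↑ z - ↑ D
          z²-D-cast = trans (sym (↑-* (m ℤ.^ N) V))
                      (trans (cong ↑_ (sym (proj₂ m^N∣z²-D)))
                      (trans (↑-- (z ℤ.* z) D) (cong (_- ↑ D) (↑-* z z))))
          regroup₁ : ∀ h q g r i → h * q * (g * r * i) ≡ g * h * q * r * i
          regroup₁ = solve-∀ ℚ-ring
          regroup₂ : ∀ p v r i → p * v * r * i ≡ r * v * (p * i)
          regroup₂ = solve-∀ ℚ-ring

    integral-translation : ∀ {A D b c} → SquareModPowers m D → A ≢ 0ℤ → b ∈ℤ[1/m] → c ∈ℤ[1/m] →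
                           b * b - four * ↑ A * c ≡ ↑ D → IntegralTranslation A b c
    integral-translation {A} {D} {b} {c} squares A≢0 (inℤ[1/m] (k , B , bm^k≡B)) c∈ disc≡D =
      translation (squares N) (bézout-^ h⊥m (k ℕ.+ N))
      where
      4A≢0 : + 4 ℤ.* A ≢ 0ℤ
      4A≢0 4A≡0 with ℤ.i*j≡0⇒i≡0∨j≡0 (+ 4) 4A≡0
      ... | inj₂ A≡0 = A≢0 A≡0
      open CoprimeSplit (coprimeSplit m 4A≢0)
      translation : ∃[ s ] ∃[ E ] (s ℤ.* s ≡ D ℤ.+ m ℤ.^ N ℤ.* E) → BézoutCoprime h (m ℤ.^ (k ℕ.+ N)) →
                    IntegralTranslation A b c
      translation (s , E , s²≡D+m^NE) (α , β , αh+βm^k+N≡1) = t , t∈ , (z , linear-coefficient) , q-integral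
        where
        open Translation {A} {D} {b} {c} disc≡D c∈ {k} {B} bm^k≡B {g} {h} {r} {N} x≡g*h g*r≡m^N h⊥m
                         {s} {E} s²≡D+m^NE {α} {β} αh+βm^k+N≡1

    leading-nonzero : ∀ {D} Q → D ≢ 0ℤ → disc Q ≡ ↑ D → ∃[ Q′ ] (a Q′ ≢ 0ℚ × SL2Equiv m Q Q′)
    leading-nonzero {D} Q@(bqf a b c) D≢0 disc≡D with a ℚ.≟ 0ℚ | c ℚ.≟ 0ℚ
    ... | no a≢0  | _       = Q , a≢0 , SL2Equiv-refl Q
    ... | yes _   | no c≢0  = act Q S , c≢0 ∘ trans (sym (Q[0,1] a b c)) , S , S-InSL2 , refl
      where
      S = mat 0ℚ (- 1ℚ) 1ℚ 0ℚ
      S-InSL2 : InSL2 m S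
      S-InSL2 = integral-InSL2 0ℤ (ℤ.- 1ℤ) 1ℤ 0ℤ refl
      Q[0,1] : ∀ a b c → a * 0ℚ * 0ℚ + b * 0ℚ * 1ℚ + c * 1ℚ * 1ℚ ≡ c
      Q[0,1] = solve-∀ ℚ-ring
    ... | yes refl | yes refl = act Q T , b≢0 ∘ trans (sym (Q[1,1] b)) , T , T-InSL2 , refl
      where
      T = mat 1ℚ 0ℚ 1ℚ 1ℚ
      T-InSL2 : InSL2 m T
      T-InSL2 = integral-InSL2 1ℤ 0ℤ 1ℤ 1ℤ refl
      Q[1,1] : ∀ b → 0ℚ * 1ℚ * 1ℚ + b * 1ℚ * 1ℚ + 0ℚ * 1ℚ * 1ℚ ≡ b
      Q[1,1] = solve-∀ ℚ-ring
      b≢0 : b ≢ 0ℚ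
      b≢0 refl = D≢0 (↑-injective {D} {0ℤ} (sym disc≡D))

    leading-integral : ∀ Q → FormOver m Q → a Q ≢ 0ℚ →
                       ∃[ A ] ∃[ Q′ ] (A ≢ 0ℤ × a Q′ ≡ ↑ A × SL2Equiv m Q Q′)
    leading-integral Q@(bqf a b c) ((k , A₀ , am^k≡A₀) , _) a≢0 =
      A , act Q U , A≢0 , a′≡A , U , U-InSL2 , refl
      where
      open ≡-Reasoning
      U = mat (m^ k) 0ℚ 0ℚ (m⁻^ k)
      U-InSL2 : InSL2 m U
      U-InSL2 = witness (↑-closed (m ℤ.^ k)) , witness (↑-closed 0ℤ) , witness (↑-closed 0ℤ) , witness (m⁻^-closed k) ,
                trans (det-diag (m^ k) (m⁻^ k)) (m^*m⁻^ k)
        where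
        det-diag : ∀ x y → x * y - 0ℚ * 0ℚ ≡ x * y
        det-diag = solve-∀ ℚ-ring
      A = A₀ ℤ.* m ℤ.^ k
      am^km^k≡A : a * m^ k * m^ k ≡ ↑ A
      am^km^k≡A = trans (cong (_* m^ k) am^k≡A₀) (sym (↑-* A₀ (m ℤ.^ k)))
      a′≡A : a * m^ k * m^ k + b * m^ k * 0ℚ + c * 0ℚ * 0ℚ ≡ ↑ A
      a′≡A = trans (Q[x,0] a b c (m^ k)) am^km^k≡A
        where
        Q[x,0] : ∀ a b c x → a * x * x + b * x * 0ℚ + c * 0ℚ * 0ℚ ≡ a * x * x
        Q[x,0] = solve-∀ ℚ-ring
      A≢0 : A ≢ 0ℤ
      A≢0 A≡0 = a≢0 (begin
        a                                 ≡⟨ sym (unit a) ⟩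
        a * 1ℚ * 1ℚ                       ≡⟨ cong (λ u → a * u * u) (sym (m^*m⁻^ k)) ⟩
        a * (m^ k * m⁻^ k) * (m^ k * m⁻^ k) ≡⟨ regroup a (m^ k) (m⁻^ k) ⟩
        a * m^ k * m^ k * m⁻^ k * m⁻^ k   ≡⟨ cong (λ u → u * m⁻^ k * m⁻^ k) (trans am^km^k≡A (cong ↑_ A≡0)) ⟩
        0ℚ * m⁻^ k * m⁻^ k                ≡⟨ zeroˡ (m⁻^ k) ⟩
        0ℚ                                ∎)
        where
        unit : ∀ a → a * 1ℚ * 1ℚ ≡ a
        unit = solve-∀ ℚ-ring
        regroup : ∀ a p i → a * (p * i) * (p * i) ≡ a * p * p * i * i
        regroup = solve-∀ ℚ-ring
        zeroˡ : ∀ i → 0ℚ * i * i ≡ 0ℚ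
        zeroˡ = solve-∀ ℚ-ring

    integral-form : ∀ {A D} Q → SquareModPowers m D → A ≢ 0ℤ → a Q ≡ ↑ A → FormOver m Q → disc Q ≡ ↑ D →
                    ∃[ Q′ ] (IntegralForm Q′ × SL2Equiv m Q Q′)
    integral-form {A} {D} Q@(bqf _ b c) squares A≢0 refl (_ , b∈ , c∈) disc≡D =
      translate (integral-translation {A} {D} {b} {c} squares A≢0 (inℤ[1/m] b∈) (inℤ[1/m] c∈) disc≡D)
      where
      translate : IntegralTranslation A b c → ∃[ Q′ ] (IntegralForm Q′ × SL2Equiv m Q Q′)
      translate (t , t∈ , (z , 2At+b≡z) , (w , At²+bt+c≡w)) =
        bqf (↑ A) (↑ z) (↑ w) , (A , z , w , refl) , V , V-InSL2 ,
        bqf-cong (coeff-a (↑ A) b c) (trans (coeff-b (↑ A) b c t) 2At+b≡z) (trans (coeff-c (↑ A) b c t) At²+bt+c≡w)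
        where
        V = mat 1ℚ t 0ℚ 1ℚ
        V-InSL2 : InSL2 m V
        V-InSL2 = witness (↑-closed 1ℤ) , witness t∈ , witness (↑-closed 0ℤ) , witness (↑-closed 1ℤ) , det-V t
          where
          det-V : ∀ t → 1ℚ * 1ℚ - t * 0ℚ ≡ 1ℚ
          det-V = solve-∀ ℚ-ring
        coeff-a : ∀ a b c → a * 1ℚ * 1ℚ + b * 1ℚ * 0ℚ + c * 0ℚ * 0ℚ ≡ a
        coeff-a = solve-∀ ℚ-ring
        coeff-b : ∀ a b c t → two * a * 1ℚ * t + b * (1ℚ * 1ℚ + t * 0ℚ) + two * c * 0ℚ * 1ℚ ≡ two * a * t + b
        coeff-b = solve-∀ ℚ-ring
        coeff-c : ∀ a b c t → a * t * t + b * t * 1ℚ + c * 1ℚ * 1ℚ ≡ a * t * t + b * t + c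
        coeff-c = solve-∀ ℚ-ring

open import Data.Integer using (ℤ; _-_; _*_; +_)
open Arithmetic using (1-4m≢0; 1-4m-squareModPowers)

corollary2p3 : (m : ℤ) → m ≢ + 0 → (Q : BQF) → FormOver m Q
    → disc Q ≡ ℤ→ℚ (+ 1 - + 4 * m)
    → ∃[ Q′ ] (IntegralForm Q′ × SL2Equiv m Q Q′)
corollary2p3 m m≢0 Q Q∈ disc≡D =
  let (Q₁ , a₁≢0 , Q~Q₁) = leading-nonzero Q (1-4m≢0 m) disc≡D
      (A , Q₂ , A≢0 , a₂≡A , Q₁~Q₂) = leading-integral Q₁ (SL2Equiv-formOver {Q} Q~Q₁ Q∈) a₁≢0
      Q~Q₂ = SL2Equiv-trans {Q} Q~Q₁ Q₁~Q₂
      (Q₃ , Q₃-integral , Q₂~Q₃) = integral-form {D = + 1 - + 4 * m} Q₂ (1-4m-squareModPowers m) A≢0 a₂≡A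
                                     (SL2Equiv-formOver {Q} Q~Q₂ Q∈) (trans (SL2Equiv-disc {Q} Q~Q₂) disc≡D)
  in Q₃ , Q₃-integral , SL2Equiv-trans {Q} Q~Q₂ Q₂~Q₃
  where open Forms.Localisation m m≢0
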